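{- For any set $X\subseteq\mathbb{N}$, there is a set $A \subseteq \mathbb{N}$ of positive lower density such that all subsets of $A$ of positive lower density compute $X$ uniformly, i.e.\ there is a single Turing functional $\Phi$ with $\Phi(B) = X$ for every $B\subseteq A$ of positive lower density.
   Context: The lower density of $A$ is $\liminf_{n\to\infty}\frac{|A\cap\{0,\ldots,n\}|}{n+1}$. -}

module Defs where

open import Data.Nat using (ℕ; zero; suc; _+_; _*_; _≤_; _<_)
open import Data.Bool using (Bool; true; false; if_then_else_)
open import Data.Fin using (Fin)
open import Data.Vec using (Vec; []; _∷_; lookup)
open import Data.Product using (Σ; _×_; _,_)
open import Relation.Binary.PropositionalEquality using (_≡_)

Set-ℕ : Set
Set-ℕ = ℕ → Bool

_⊆ₛ_ : Set-ℕ → Set-ℕ → Set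
B ⊆ₛ A = ∀ n → B n ≡ true → A n ≡ true

count : Set-ℕ → ℕ → ℕ
count A zero    = if A zero then 1 else 0
count A (suc n) = (if A (suc n) then 1 else 0) + count A n

-- A has positive lower density:
--   liminf_n |A ∩ {0..n}| / (n+1) > 0,
-- i.e. there is a rational ε = 1/(k+1) > 0 and N such that for all n ≥ N,
--   |A ∩ {0..n}| / (n+1) ≥ ε,  i.e.  n + 1 ≤ (k+1) · |A ∩ {0..n}|.
PosLowerDensity : Set-ℕ → Set
PosLowerDensity A =
  Σ ℕ λ k → Σ ℕ λ N → ∀ n → N ≤ n → suc n ≤ suc k * count A n

-- Turing functionals, modelled as oracle μ-recursive function codes.
-- Code k = code of a k-ary partial function with access to an oracle.
data Code : ℕ → Set where
  zeroF : ∀ {k} → Code k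
  succF : Code 1
  proj  : ∀ {k} → Fin k → Code k
  orc   : Code 1
  comp  : ∀ {k m} → Code m → Vec (Code k) m → Code k
  prec  : ∀ {k} → Code k → Code (suc (suc k)) → Code (suc k)
  mu    : ∀ {k} → Code (suc k) → Code k

data Eval (O : Set-ℕ) : ∀ {k} → Code k → Vec ℕ k → ℕ → Set
data EvalAll (O : Set-ℕ) : ∀ {k m} → Vec (Code k) m → Vec ℕ k → Vec ℕ m → Set

data Eval O where
  ev-zero : ∀ {k} {xs : Vec ℕ k} → Eval O zeroF xs 0
  ev-succ : ∀ {x} → Eval O succF (x ∷ []) (suc x)
  ev-proj : ∀ {k} {i : Fin k} {xs} → Eval O (proj i) xs (lookup xs i)
  ev-orc  : ∀ {x} → Eval O orc (x ∷ []) (if O x then 1 else 0)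
  ev-comp : ∀ {k m} {f : Code m} {gs : Vec (Code k) m} {xs ys y} →
            EvalAll O gs xs ys → Eval O f ys y → Eval O (comp f gs) xs y
  ev-prec-z : ∀ {k} {g : Code k} {h} {xs y} →
              Eval O g xs y → Eval O (prec g h) (0 ∷ xs) y
  ev-prec-s : ∀ {k} {g : Code k} {h} {n xs y z} →
              Eval O (prec g h) (n ∷ xs) y → Eval O h (n ∷ y ∷ xs) z →
              Eval O (prec g h) (suc n ∷ xs) z
  ev-mu : ∀ {k} {f : Code (suc k)} {xs n} →
          Eval O f (n ∷ xs) 0 →
          (∀ i → i < n → Σ ℕ λ v → Eval O f (i ∷ xs) (suc v)) →
          Eval O (mu f) xs n

data EvalAll O where
  all-[] : ∀ {k} {xs : Vec ℕ k} → EvalAll O [] xs []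
  all-∷  : ∀ {k m} {g : Code k} {gs : Vec (Code k) m} {xs y ys} →
           Eval O g xs y → EvalAll O gs xs ys → EvalAll O (g ∷ gs) xs (y ∷ ys)

Computes : Code 1 → Set-ℕ → Set-ℕ → Set
Computes Φ B X = ∀ n → Eval B Φ (n ∷ []) (if X n then 1 else 0)

{-# OPTIONS --safe #-}
module Submission where

-- Cut ℕ into the blocks [s, s²) for s = 2, 4, 16, 256, …, and label them so
-- that the labels count down by one from block to block, restarting at s
-- after label 0 on the block [s, s²). Every label then recurs on blocks
-- [s, s²) with s arbitrarily large. A set of lower density at least 1/(k+1)
-- meets every block [s, s²) with s large enough, because up to s² - 1 it
-- has at least s²/(k+1) > s elements. Let A pick from each pair {2i, 2i+1}
-- (which never straddles a block boundary) the element whose parity is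
-- X(label): then A has density 1/2, and for B ⊆ A of positive lower
-- density, X(n) is the parity of the first element of B with label n.

open import Defs
open import Data.Nat using (ℕ; zero; suc; _+_; _*_; _∸_; pred; _≤_; _<_; _≡ᵇ_; z≤n; s≤s; _≟_)
open import Data.Nat.Properties
open import Data.Nat.Tactic.RingSolver using (solve-∀)
open import Data.Bool using (Bool; true; false; if_then_else_; T)
open import Data.Unit using (tt)
open import Data.Product using (Σ; _×_; _,_; proj₁; proj₂)
open import Data.Sum using (_⊎_; inj₁; inj₂)
open import Data.Empty using (⊥-elim)
open import Data.Fin using () renaming (zero to fz; suc to fs)
open import Data.Vec using (Vec; []; _∷_)
open import Relation.Nullary using (yes; no)
open import Relation.Nullary.Decidable using (dec-true; dec-false)
open import Relation.Binary.PropositionalEquality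

bit : Bool → ℕ
bit b = if b then 1 else 0

T-≡ᵇ⇒≡ : ∀ {m n} → (m ≡ᵇ n) ≡ true → m ≡ n
T-≡ᵇ⇒≡ {m} {n} eq = ≡ᵇ⇒≡ m n (subst T (sym eq) tt)

#0 : ∀ {k} → Code (suc k)
#0 = proj fz

#1 : ∀ {k} → Code (suc (suc k))
#1 = proj (fs fz)

eval-comp₁ : ∀ {O k} {f : Code 1} {g : Code k} {xs y z} →
  Eval O g xs y → Eval O f (y ∷ []) z → Eval O (comp f (g ∷ [])) xs z
eval-comp₁ eg ef = ev-comp (all-∷ eg all-[]) ef

eval-comp₂ : ∀ {O k} {f : Code 2} {g₁ g₂ : Code k} {xs y₁ y₂ z} →
  Eval O g₁ xs y₁ → Eval O g₂ xs y₂ → Eval O f (y₁ ∷ y₂ ∷ []) z →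
  Eval O (comp f (g₁ ∷ g₂ ∷ [])) xs z
eval-comp₂ e₁ e₂ ef = ev-comp (all-∷ e₁ (all-∷ e₂ all-[])) ef

eval-comp₃ : ∀ {O k} {f : Code 3} {g₁ g₂ g₃ : Code k} {xs y₁ y₂ y₃ z} →
  Eval O g₁ xs y₁ → Eval O g₂ xs y₂ → Eval O g₃ xs y₃ →
  Eval O f (y₁ ∷ y₂ ∷ y₃ ∷ []) z → Eval O (comp f (g₁ ∷ g₂ ∷ g₃ ∷ [])) xs z
eval-comp₃ e₁ e₂ e₃ ef = ev-comp (all-∷ e₁ (all-∷ e₂ (all-∷ e₃ all-[]))) ef

eval-prec : ∀ {O k} {g : Code k} {h : Code (suc (suc k))} {xs : Vec ℕ k}
  (F : ℕ → ℕ) → Eval O g xs (F 0) →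
  (∀ n → Eval O h (n ∷ F n ∷ xs) (F (suc n))) →
  ∀ n → Eval O (prec g h) (n ∷ xs) (F n)
eval-prec F g0 hs zero    = ev-prec-z g0
eval-prec F g0 hs (suc n) = ev-prec-s (eval-prec F g0 hs n) (hs n)

PositiveBelow : (ℕ → ℕ) → ℕ → Set
PositiveBelow F b = ∀ i → i < b → Σ ℕ λ v → F i ≡ suc v

first-zero-below : ∀ (F : ℕ → ℕ) b →
  (Σ ℕ λ m → F m ≡ 0 × PositiveBelow F m) ⊎ PositiveBelow F b
first-zero-below F zero = inj₂ (λ i ())
first-zero-below F (suc b) with first-zero-below F b
... | inj₁ found = inj₁ found
... | inj₂ pos with F b in eq
...   | zero  = inj₁ (b , eq , pos)
...   | suc v = inj₂ extend
  where
  extend : PositiveBelow F (suc b)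
  extend i i<1+b with m<1+n⇒m<n∨m≡n i<1+b
  ... | inj₁ i<b  = pos i i<b
  ... | inj₂ refl = v , eq

first-zero : ∀ (F : ℕ → ℕ) m → F m ≡ 0 → Σ ℕ λ m₀ → F m₀ ≡ 0 × PositiveBelow F m₀
first-zero F m Fm≡0 with first-zero-below F (suc m)
... | inj₁ found = found
... | inj₂ pos with pos m ≤-refl
...   | v , Fm≡1+v = ⊥-elim (0≢1+n (trans (sym Fm≡0) Fm≡1+v))

eval-mu : ∀ {O k} {f : Code (suc k)} {xs} (F : ℕ → ℕ) →
  (∀ i → Eval O f (i ∷ xs) (F i)) → ∀ m → F m ≡ 0 →
  Σ ℕ λ m₀ → F m₀ ≡ 0 × Eval O (mu f) xs m₀
eval-mu {O} {f = f} {xs} F evalF m Fm≡0 with first-zero F m Fm≡0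
... | m₀ , Fm₀≡0 , pos = m₀ , Fm₀≡0 , ev-mu (evalAt Fm₀≡0) below
  where
  evalAt : ∀ {i y} → F i ≡ y → Eval O f (i ∷ xs) y
  evalAt {i} Fi≡y = subst (Eval O f (i ∷ xs)) Fi≡y (evalF i)
  below : ∀ i → i < m₀ → Σ ℕ λ v → Eval O f (i ∷ xs) (suc v)
  below i i<m₀ with pos i i<m₀
  ... | v , Fi≡1+v = v , evalAt Fi≡1+v

oneC : ∀ {k} → Code k
oneC = comp succF (zeroF ∷ [])

oneC-correct : ∀ {O k} {xs : Vec ℕ k} → Eval O oneC xs 1
oneC-correct = eval-comp₁ ev-zero ev-succ

addC : Code 2
addC = prec #0 (comp succF (#1 ∷ []))

addC-correct : ∀ {O} x y → Eval O addC (x ∷ y ∷ []) (x + y)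
addC-correct x y = eval-prec (_+ y) ev-proj (λ _ → eval-comp₁ ev-proj ev-succ) x

predC : Code 1
predC = prec zeroF #0

predC-correct : ∀ {O} x → Eval O predC (x ∷ []) (pred x)
predC-correct = eval-prec pred ev-zero (λ _ → ev-proj)

-- primitive recursion runs on the first argument, so the subtrahend comes first
flippedMonusC : Code 2
flippedMonusC = prec #0 (comp predC (#1 ∷ []))

flippedMonusC-correct : ∀ {O} y x → Eval O flippedMonusC (y ∷ x ∷ []) (x ∸ y)
flippedMonusC-correct {O} y x = eval-prec (x ∸_) ev-proj
  (λ n → subst (Eval O _ _) (pred[m∸n]≡m∸[1+n] x n) (eval-comp₁ ev-proj (predC-correct (x ∸ n)))) y

monusC : Code 2
monusC = comp flippedMonusC (#1 ∷ #0 ∷ [])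

monusC-correct : ∀ {O} x y → Eval O monusC (x ∷ y ∷ []) (x ∸ y)
monusC-correct x y = eval-comp₂ ev-proj ev-proj (flippedMonusC-correct y x)

mulC : Code 2
mulC = prec zeroF (comp addC (#1 ∷ proj (fs (fs fz)) ∷ []))

mulC-correct : ∀ {O} x y → Eval O mulC (x ∷ y ∷ []) (x * y)
mulC-correct {O} x y = eval-prec (_* y) ev-zero
  (λ n → subst (Eval O _ _) (+-comm (n * y) y) (eval-comp₂ ev-proj ev-proj (addC-correct (n * y) y))) x

ifZero : ℕ → ℕ → ℕ → ℕ
ifZero zero    a b = a
ifZero (suc _) a b = b

ifZeroC : Code 3
ifZeroC = prec #0 (proj (fs (fs (fs fz))))

ifZeroC-correct : ∀ {O} c a b → Eval O ifZeroC (c ∷ a ∷ b ∷ []) (ifZero c a b)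
ifZeroC-correct c a b = eval-prec (λ c → ifZero c a b) ev-proj (λ _ → ev-proj) c

ifZero-distance : ∀ x y a b → ifZero ((x ∸ y) + (y ∸ x)) a b ≡ (if x ≡ᵇ y then a else b)
ifZero-distance zero    zero    a b = refl
ifZero-distance zero    (suc y) a b = refl
ifZero-distance (suc x) zero    a b = refl
ifZero-distance (suc x) (suc y) a b = ifZero-distance x y a b

ifEqC : ∀ {k} → Code k → Code k → Code k → Code k → Code k
ifEqC {k} f g a b = comp ifZeroC (distance ∷ a ∷ b ∷ [])
  where
  distance : Code k
  distance = comp addC (comp monusC (f ∷ g ∷ []) ∷ comp monusC (g ∷ f ∷ []) ∷ [])

ifEqC-correct : ∀ {O k} {f g a b : Code k} {xs x y u v} →
  Eval O f xs x → Eval O g xs y → Eval O a xs u → Eval O b xs v →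
  Eval O (ifEqC f g a b) xs (if x ≡ᵇ y then u else v)
ifEqC-correct {O} {x = x} {y} {u} {v} ef eg ea eb =
  subst (Eval O _ _) (ifZero-distance x y u v)
    (eval-comp₃ (eval-comp₂ (eval-comp₂ ef eg (monusC-correct x y))
                            (eval-comp₂ eg ef (monusC-correct y x))
                            (addC-correct _ _))
                ea eb (ifZeroC-correct _ u v))

-- Labelled blocks

-- blockEnd m is the exclusive right end of the block containing m.
blockEnd : ℕ → ℕ
blockEnd zero    = 2
blockEnd (suc m) = if suc m ≡ᵇ blockEnd m then blockEnd m * blockEnd m else blockEnd m

nextLabel : ℕ → ℕ → ℕ
nextLabel l s = ifZero l s (pred l)

label : ℕ → ℕ
label zero    = 0
label (suc m) = if suc m ≡ᵇ blockEnd m then nextLabel (label m) (blockEnd m) else label m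

blockEndC : Code 1
blockEndC = prec (comp succF (oneC ∷ []))
  (ifEqC (comp succF (#0 ∷ [])) #1 (comp mulC (#1 ∷ #1 ∷ [])) #1)

blockEndC-correct : ∀ {O} m → Eval O blockEndC (m ∷ []) (blockEnd m)
blockEndC-correct = eval-prec blockEnd (eval-comp₁ oneC-correct ev-succ)
  (λ n → ifEqC-correct (eval-comp₁ ev-proj ev-succ) ev-proj
           (eval-comp₂ ev-proj ev-proj (mulC-correct _ _)) ev-proj)

labelC : Code 1
labelC = prec zeroF
  (ifEqC (comp succF (#0 ∷ [])) blockEnd#0
         (comp ifZeroC (#1 ∷ blockEnd#0 ∷ comp predC (#1 ∷ []) ∷ [])) #1)
  where
  blockEnd#0 : Code 2
  blockEnd#0 = comp blockEndC (#0 ∷ [])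

labelC-correct : ∀ {O} m → Eval O labelC (m ∷ []) (label m)
labelC-correct = eval-prec label ev-zero
  (λ n → ifEqC-correct (eval-comp₁ ev-proj ev-succ) (blockEnd#0 n)
           (eval-comp₃ ev-proj (blockEnd#0 n) (eval-comp₁ ev-proj (predC-correct _))
                       (ifZeroC-correct _ _ _))
           ev-proj)
  where
  blockEnd#0 : ∀ {O} n {l} → Eval O (comp blockEndC (#0 ∷ [])) (n ∷ l ∷ []) (blockEnd n)
  blockEnd#0 n = eval-comp₁ ev-proj (blockEndC-correct n)

inside-block : ∀ m → suc m ≢ blockEnd m →
  blockEnd (suc m) ≡ blockEnd m × label (suc m) ≡ label m
inside-block m ne rewrite dec-false (suc m ≟ blockEnd m) ne = refl , refl

at-boundary : ∀ m → suc m ≡ blockEnd m →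
  blockEnd (suc m) ≡ blockEnd m * blockEnd m × label (suc m) ≡ nextLabel (label m) (blockEnd m)
at-boundary m eq rewrite dec-true (suc m ≟ blockEnd m) eq = refl , refl

BlockStart : ℕ → ℕ → Set
BlockStart s l = 2 ≤ s × blockEnd s ≡ s * s × label s ≡ l

blockStart-2 : BlockStart 2 2
blockStart-2 = s≤s (s≤s z≤n) , refl , refl

n<n*n : ∀ {s} → 2 ≤ s → s < s * s
n<n*n {suc (suc t)} 2≤s = m<m*n (suc (suc t)) (suc (suc t)) 2≤s
n<n*n {suc zero} (s≤s ())

blockStart-< : ∀ {s l} → BlockStart s l → s < s * s
blockStart-< (2≤s , _) = n<n*n 2≤s

constant-on-block : ∀ {s l} → BlockStart s l → ∀ d → d + s < s * s →
  blockEnd (d + s) ≡ s * s × label (d + s) ≡ l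
constant-on-block (_ , end , lab) zero _ = end , lab
constant-on-block {s} start (suc d) lt with constant-on-block start d (<-trans (n<1+n _) lt)
... | end , lab with inside-block (d + s) (λ eq → <-irrefl (trans eq end) lt)
...   | end′ , lab′ = trans end′ end , trans lab′ lab

label-on-block : ∀ {s l m} → BlockStart s l → s ≤ m → m < s * s → label m ≡ l
label-on-block {s} {l} {m} start s≤m m<s*s =
  subst (λ t → label t ≡ l) d+s≡m
    (proj₂ (constant-on-block start (m ∸ s) (subst (_< s * s) (sym d+s≡m) m<s*s)))
  where
  d+s≡m : (m ∸ s) + s ≡ m
  d+s≡m = m∸n+n≡m s≤m

nextBlockStart : ∀ {s l} → BlockStart s l → BlockStart (s * s) (nextLabel l (s * s))
nextBlockStart {s} {l} start@(2≤s , _) =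
  ≤-trans 2≤s (<⇒≤ s<s*s) ,
  trans (cong blockEnd (sym 1+m≡s*s)) (trans (proj₁ boundary) (cong₂ _*_ end end)) ,
  trans (cong label (sym 1+m≡s*s)) (trans (proj₂ boundary) (cong₂ nextLabel lab end))
  where
  s<s*s : s < s * s
  s<s*s = n<n*n 2≤s
  m : ℕ
  m = (s * s ∸ suc s) + s
  1+m≡s*s : suc m ≡ s * s
  1+m≡s*s = trans (sym (+-suc _ s)) (m∸n+n≡m s<s*s)
  lastOfBlock : blockEnd m ≡ s * s × label m ≡ l
  lastOfBlock = constant-on-block start (s * s ∸ suc s) (subst (m <_) 1+m≡s*s (n<1+n m))
  end : blockEnd m ≡ s * s
  end = proj₁ lastOfBlock
  lab : label m ≡ l
  lab = proj₂ lastOfBlock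
  boundary : blockEnd (suc m) ≡ blockEnd m * blockEnd m × label (suc m) ≡ nextLabel (label m) (blockEnd m)
  boundary = at-boundary m (trans 1+m≡s*s (sym end))

descend : ∀ l {s} j → BlockStart s l → j ≤ l → Σ ℕ λ s′ → BlockStart s′ j × s ≤ s′
descend zero    .zero start z≤n = _ , start , ≤-refl
descend (suc l) j start j≤1+l with j ≟ suc l
... | yes refl = _ , start , ≤-refl
... | no j≢1+l with descend l j (nextBlockStart start) (≤-pred (≤∧≢⇒< j≤1+l j≢1+l))
...   | s′ , start′ , s*s≤s′ = s′ , start′ , ≤-trans (<⇒≤ (blockStart-< start)) s*s≤s′

-- after a block labelled 0 at s, the next one is labelled s*s ≥ s
later-blockStart : ∀ {s} → BlockStart s 0 → ∀ n → n ≤ s → Σ ℕ λ s′ → BlockStart s′ n × s < s′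
later-blockStart {s} start n n≤s
  with descend (s * s) n (nextBlockStart start) (≤-trans n≤s (<⇒≤ (blockStart-< start)))
... | s′ , start′ , s*s≤s′ = s′ , start′ , <-≤-trans (blockStart-< start) s*s≤s′

late-blockStart-0 : ∀ K → Σ ℕ λ s → BlockStart s 0 × K ≤ s
late-blockStart-0 zero with descend 2 0 blockStart-2 z≤n
... | s , start , _ = s , start , z≤n
late-blockStart-0 (suc K) with late-blockStart-0 K
... | s , start , K≤s with later-blockStart start 0 z≤n
...   | s′ , start′ , s<s′ = s′ , start′ , ≤-<-trans K≤s s<s′

late-blockStart : ∀ K n → Σ ℕ λ s → BlockStart s n × K < s
late-blockStart K n with late-blockStart-0 (K + n)
... | s , start , K+n≤s with later-blockStart start n (≤-trans (m≤n+m n K) K+n≤s)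
...   | s′ , start′ , s<s′ = s′ , start′ , ≤-<-trans (≤-trans (m≤m+n K n) K+n≤s) s<s′

-- Sets of positive lower density meet all late blocks

bit≤1 : ∀ b → bit b ≤ 1
bit≤1 true  = ≤-refl
bit≤1 false = z≤n

count-≤ : ∀ B n → count B n ≤ suc n
count-≤ B zero    = bit≤1 (B zero)
count-≤ B (suc n) = +-mono-≤ (bit≤1 (B (suc n))) (count-≤ B n)

count-mono : ∀ B {m n} → m ≤ n → count B m ≤ count B n
count-mono B {n = zero} z≤n = ≤-refl
count-mono B {m} {suc n} m≤1+n with m≤n⇒m<n∨m≡n m≤1+n
... | inj₁ m<1+n = ≤-trans (count-mono B (≤-pred m<1+n)) (m≤n+m _ (bit (B (suc n))))
... | inj₂ refl  = ≤-refl

count-<⇒member : ∀ B {a} b → a ≤ b → count B a < count B b →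
  Σ ℕ λ m → a < m × m ≤ b × B m ≡ true
count-<⇒member B zero z≤n lt = ⊥-elim (<-irrefl refl lt)
count-<⇒member B (suc b) a≤1+b lt with m≤n⇒m<n∨m≡n a≤1+b
... | inj₂ refl = ⊥-elim (<-irrefl refl lt)
... | inj₁ a<1+b with B (suc b) in B[1+b]
...   | true  = suc b , a<1+b , ≤-refl , B[1+b]
...   | false with count-<⇒member B b (≤-pred a<1+b) lt
...     | m , a<m , m≤b , Bm = m , a<m , m≤n⇒m≤1+n m≤b , Bm

DensityBound : Set-ℕ → ℕ → ℕ → Set
DensityBound B k N = ∀ n → N ≤ n → suc n ≤ suc k * count B n

dense-meets-interval : ∀ {B k N} → DensityBound B k N → ∀ a b → N ≤ b → suc k * suc a < suc b →
  Σ ℕ λ m → a < m × m ≤ b × B m ≡ true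
dense-meets-interval {B} {k} dense a b N≤b long =
  count-<⇒member B b a≤b (≤-<-trans (count-≤ B a) manyElements)
  where
  a≤b : a ≤ b
  a≤b = ≤-pred (<⇒≤ (≤-<-trans (m≤n*m (suc a) (suc k)) long))
  manyElements : suc a < count B b
  manyElements = *-cancelˡ-< (suc k) (suc a) (count B b) (<-≤-trans long (dense b N≤b))

dense-meets-block : ∀ {B k N} → DensityBound B k N → ∀ s → N + suc k < s →
  Σ ℕ λ m → s ≤ m × m < s * s × B m ≡ true
dense-meets-block {k = k} {N} dense (suc a) N+1+k<1+a
  with dense-meets-interval {k = k} dense a (a + a * suc a) N≤b long
  where
  N+1+k≤a : N + suc k ≤ a
  N+1+k≤a = ≤-pred N+1+k<1+a
  N≤b : N ≤ a + a * suc a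
  N≤b = ≤-trans (≤-trans (m≤m+n N (suc k)) N+1+k≤a) (m≤m+n a _)
  long : suc k * suc a < suc a * suc a
  long = *-monoˡ-< (suc a) (s≤s (≤-trans (m≤n+m (suc k) N) N+1+k≤a))
... | m , a<m , m≤b , Bm = m , a<m , s≤s m≤b , Bm

label-attained : ∀ {B} → PosLowerDensity B → ∀ n → Σ ℕ λ m → B m ≡ true × label m ≡ n
label-attained (k , N , dense) n with late-blockStart (N + suc k) n
... | s , start , late with dense-meets-block dense s late
...   | m , s≤m , m<s*s , Bm = m , Bm , label-on-block start s≤m m<s*s

parity : ℕ → ℕ
parity zero    = 0
parity (suc n) = 1 ∸ parity n

parity-+-self : ∀ n → parity (n + n) ≡ 0
parity-+-self zero    = refl
parity-+-self (suc n) rewrite +-suc n n | parity-+-self n = refl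

blockEnd-even : ∀ m → Σ ℕ λ q → blockEnd m ≡ q + q
blockEnd-even zero = 1 , refl
blockEnd-even (suc m) with blockEnd-even m | suc m ≟ blockEnd m
... | q , end≡2q | yes atEnd = q * (q + q) ,
  trans (proj₁ (at-boundary m atEnd)) (trans (cong₂ _*_ end≡2q end≡2q) (*-distribʳ-+ (q + q) q q))
... | q , end≡2q | no inside = q , trans (proj₁ (inside-block m inside)) end≡2q

label-even-step : ∀ x → parity x ≡ 0 → label (suc x) ≡ label x
label-even-step x even = proj₂ (inside-block x 1+x≢end)
  where
  1+x≢end : suc x ≢ blockEnd x
  1+x≢end eq with blockEnd-even x
  ... | q , end≡2q = 0≢1+n (sym (trans (cong (1 ∸_) (sym even))
                                 (trans (cong parity (trans eq end≡2q)) (parity-+-self q))))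

A : Set-ℕ → Set-ℕ
A X m = parity m ≡ᵇ bit (X (label m))

A-pair : ∀ X x → parity x ≡ 0 → bit (A X (suc x)) + bit (A X x) ≡ 1
A-pair X x even with X (label x) in Xl
... | true  rewrite label-even-step x even | even | Xl = refl
... | false rewrite label-even-step x even | even | Xl = refl

count-A-odd : ∀ X i → count (A X) (suc (i + i)) ≡ suc i
count-A-odd X zero    = A-pair X 0 refl
count-A-odd X (suc i) rewrite +-suc i i = begin
  bit (A X (suc x)) + (bit (A X x) + count (A X) (suc (i + i)))
    ≡⟨ sym (+-assoc (bit (A X (suc x))) _ _) ⟩
  (bit (A X (suc x)) + bit (A X x)) + count (A X) (suc (i + i))
    ≡⟨ cong₂ _+_ (A-pair X x (cong (λ p → 1 ∸ (1 ∸ p)) (parity-+-self i))) (count-A-odd X i) ⟩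
  suc (suc i) ∎
  where
  open ≡-Reasoning
  x : ℕ
  x = suc (suc (i + i))

halve : ∀ p → Σ ℕ λ i → i + i ≤ p × p ≤ suc (i + i)
halve zero          = 0 , z≤n , z≤n
halve (suc zero)    = 0 , z≤n , ≤-refl
halve (suc (suc p)) with halve p
... | i , lo , hi = suc i , s≤s (subst (_≤ suc p) 1+2i≡i+[1+i] (s≤s lo)) ,
                           s≤s (s≤s (subst (p ≤_) 1+2i≡i+[1+i] hi))
  where
  1+2i≡i+[1+i] : suc (i + i) ≡ i + suc i
  1+2i≡i+[1+i] = sym (+-suc i i)

A-dense : ∀ X → PosLowerDensity (A X)
A-dense X = 2 , 1 , λ { (suc p) _ → bound p }
  where
  bound : ∀ p → suc (suc p) ≤ 3 * count (A X) (suc p)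
  bound p with halve p
  ... | i , 2i≤p , p≤1+2i = begin
    suc (suc p)                    ≤⟨ s≤s (s≤s p≤1+2i) ⟩
    3 + (i + i)                    ≤⟨ m≤m+n (3 + (i + i)) i ⟩
    3 + (i + i) + i                ≡⟨ 3+2i+i≡3*[1+i] i ⟩
    3 * suc i                      ≡⟨ cong (3 *_) (count-A-odd X i) ⟨
    3 * count (A X) (suc (i + i))  ≤⟨ *-monoʳ-≤ 3 (count-mono (A X) (s≤s 2i≤p)) ⟩
    3 * count (A X) (suc p)        ∎
    where
    open ≤-Reasoning
    3+2i+i≡3*[1+i] : ∀ i → 3 + (i + i) + i ≡ 3 * suc i
    3+2i+i≡3*[1+i] = solve-∀

parityC : Code 1
parityC = prec zeroF (comp monusC (oneC ∷ #1 ∷ []))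

parityC-correct : ∀ {O} m → Eval O parityC (m ∷ []) (parity m)
parityC-correct = eval-prec parity ev-zero (λ _ → eval-comp₂ oneC-correct ev-proj (monusC-correct _ _))

searchValue : Set-ℕ → ℕ → ℕ → ℕ
searchValue B n m = if label m ≡ᵇ n then 1 ∸ bit (B m) else 1

searchC : Code 2
searchC = ifEqC (comp labelC (#0 ∷ [])) #1 (comp monusC (oneC ∷ comp orc (#0 ∷ []) ∷ [])) oneC

searchC-correct : ∀ {B} n m → Eval B searchC (m ∷ n ∷ []) (searchValue B n m)
searchC-correct n m = ifEqC-correct (eval-comp₁ ev-proj (labelC-correct m)) ev-proj
  (eval-comp₂ oneC-correct (eval-comp₁ ev-proj ev-orc) (monusC-correct _ _)) oneC-correct

searchValue≡0 : ∀ {B n m} → B m ≡ true → label m ≡ n → searchValue B n m ≡ 0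
searchValue≡0 {m = m} Bm refl rewrite dec-true (label m ≟ label m) refl | Bm = refl

searchValue≡0⇒ : ∀ {B n m} → searchValue B n m ≡ 0 → B m ≡ true × label m ≡ n
searchValue≡0⇒ {B} {n} {m} value≡0 with label m ≡ᵇ n in eq | B m
... | true  | true  = refl , T-≡ᵇ⇒≡ eq
... | true  | false = ⊥-elim (1+n≢0 value≡0)
... | false | _     = ⊥-elim (1+n≢0 value≡0)

Φ : Code 1
Φ = comp parityC (mu searchC ∷ [])

Φ-computes : ∀ X B → B ⊆ₛ A X → (∀ n → Σ ℕ λ m → B m ≡ true × label m ≡ n) → Computes Φ B X
Φ-computes X B B⊆A hits n with hits n
... | m , Bm , lm with eval-mu (searchValue B n) (searchC-correct n) m (searchValue≡0 {B} {n} {m} Bm lm)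
...   | m₀ , value≡0 , evalMu with searchValue≡0⇒ {B} {n} {m₀} value≡0
...     | Bm₀ , lm₀ = eval-comp₁ evalMu (subst (Eval B parityC (m₀ ∷ [])) parity≡ (parityC-correct m₀))
  where
  parity≡ : parity m₀ ≡ bit (X n)
  parity≡ = trans (T-≡ᵇ⇒≡ (B⊆A m₀ Bm₀)) (cong (λ l → bit (X l)) lm₀)

proposition3p1 : (X : Set-ℕ) →
    Σ Set-ℕ λ A → PosLowerDensity A ×
      Σ (Code 1) λ Φ →
        ∀ (B : Set-ℕ) → B ⊆ₛ A → PosLowerDensity B → Computes Φ B X
proposition3p1 X = A X , A-dense X , Φ , λ B B⊆A dense → Φ-computes X B B⊆A (label-attained dense)
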